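{- Let $H$ and $F$ be nonempty graphs with $m_2(H)\geq m_2(F)$. Then there exists a function $w\colon E(H)\to[1,\infty)$ such that $H$ is $(w,F)$-balanced, i.e., for every edge $e\in E(H)$, \[ \min\big\{v_I-w_I/m_2(H,F): I\subseteq H \text{ with } e\in E(I)\big\}=2-1/m_2(F), \] where $w_I:=\sum_{e'\in E(I)}w(e')$.
   Context: A graph is nonempty if it has at least one edge; $v_I$, $e_I$ denote numbers of vertices and edges of $I$. For a nonempty graph $F$, let $d_2(F):=1/2$ if $F=K_2$ and $d_2(F):=\frac{e_F-1}{v_F-2}$ otherwise, and $m_2(F):=\max\{d_2(F'):F'\subseteq F,\ e_{F'}\geq 1\}$. For nonempty graphs $H,F$ with $m_2(H)\geq m_2(F)$, \[ m_2(H,F):=\max\left\{\frac{e_{H'}}{v_{H'}-2+1/m_2(F)}: H'\subseteq H,\ e_{H'}\geq 1\right\}. \] -}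

module Defs where

open import Data.Bool using (Bool; true; false; if_then_else_; _∧_)
open import Data.Nat as ℕ using (ℕ; zero; suc)
import Data.Nat.Properties as ℕP
open import Data.Fin using (Fin; toℕ)
open import Data.List using (List; map; allFin)
import Data.List as L
open import Data.Integer using (+_)
open import Data.Rational using (ℚ; 0ℚ; 1ℚ; ½; _+_; _-_; _÷_; _≤_; _/_; ≢-nonZero)
open import Data.Rational.Properties using (_≟_)
open import Data.Product using (Σ; _×_; ∃; ∃-syntax)
open import Relation.Binary.PropositionalEquality using (_≡_)
open import Relation.Nullary using (yes; no)

record Graph : Set where
  field
    n      : ℕ
    adj    : Fin n → Fin n → Bool
    symm   : ∀ i j → adj i j ≡ adj j i
    irrefl : ∀ i → adj i i ≡ false
open Graph public

IsEdge : (G : Graph) → Fin (n G) → Fin (n G) → Set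
IsEdge G i j = (toℕ i ℕ.< toℕ j) × (adj G i j ≡ true)

Nonempty : Graph → Set
Nonempty G = ∃[ i ] ∃[ j ] IsEdge G i j

record Sub (G : Graph) : Set where
  field
    V     : Fin (n G) → Bool
    E     : Fin (n G) → Fin (n G) → Bool
    E-sym : ∀ i j → E i j ≡ E j i
    E⊆adj : ∀ i j → E i j ≡ true → adj G i j ≡ true
    E⊆V   : ∀ i j → E i j ≡ true → V i ≡ true
open Sub public

sumℕ : List ℕ → ℕ
sumℕ = L.foldr ℕ._+_ 0

sumℚ : List ℚ → ℚ
sumℚ = L.foldr _+_ 0ℚ

vI : {G : Graph} → Sub G → ℕ
vI {G} I = sumℕ (map (λ i → if V I i then 1 else 0) (allFin (n G)))

eI : {G : Graph} → Sub G → ℕ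
eI {G} I = sumℕ (map (λ i → sumℕ (map (λ j →
  if E I i j ∧ (toℕ i ℕ.<ᵇ toℕ j) then 1 else 0) (allFin (n G)))) (allFin (n G)))

-- w_I := sum of w(e') over edges e' of I (w read on pairs i < j)
wI : {G : Graph} → (Fin (n G) → Fin (n G) → ℚ) → Sub G → ℚ
wI {G} w I = sumℚ (map (λ i → sumℚ (map (λ j →
  if E I i j ∧ (toℕ i ℕ.<ᵇ toℕ j) then w i j else 0ℚ) (allFin (n G)))) (allFin (n G)))

ℕtoℚ : ℕ → ℚ
ℕtoℚ k = + k / 1

-- Division made total (returns 0 for a zero denominator; it is only used
-- with nonzero denominators below).
_÷'_ : ℚ → ℚ → ℚ
p ÷' q with q ≟ 0ℚ
... | yes _  = 0ℚ
... | no q≢0 = _÷_ p q {{≢-nonZero q≢0}}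

-- d_2 from (v, e): 1/2 for K_2 (v = 2, the only nonempty graph on 2 vertices),
-- (e-1)/(v-2) otherwise. (v < 2 never occurs for a nonempty graph.)
d2 : ℕ → ℕ → ℚ
d2 (suc (suc (suc k))) e = + (e ℕ.∸ 1) / suc k
d2 _ _ = ½

d2Sub : {G : Graph} → Sub G → ℚ
d2Sub I = d2 (vI I) (eI I)

IsMax : (G : Graph) → (Sub G → ℚ) → ℚ → Set
IsMax G f m = (Σ (Sub G) λ I → (1 ℕ.≤ eI I) × (f I ≡ m))
            × (∀ (I : Sub G) → 1 ℕ.≤ eI I → f I ≤ m)

IsM2 : Graph → ℚ → Set
IsM2 G m = IsMax G d2Sub m

IsM2HF : Graph → ℚ → ℚ → Set
IsM2HF H mF m =
  IsMax H (λ I → ℕtoℚ (eI I) ÷' ((ℕtoℚ (vI I) - ℕtoℚ 2) + (1ℚ ÷' mF))) m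

Balanced : (H : Graph) → (Fin (n H) → Fin (n H) → ℚ) → ℚ → ℚ → Set
Balanced H w mF mHF =
  ∀ i j → IsEdge H i j →
    ((∀ (I : Sub H) → E I i j ≡ true →
        (ℕtoℚ 2 - (1ℚ ÷' mF)) ≤ (ℕtoℚ (vI I) - (wI w I ÷' mHF)))
    × (Σ (Sub H) λ I → (E I i j ≡ true)
        × ((ℕtoℚ (vI I) - (wI w I ÷' mHF)) ≡ (ℕtoℚ 2 - (1ℚ ÷' mF)))))

module Submission where

-- Write c = 2 - 1/m₂(F) and val_w(I) = v_I - w_I / m₂(H,F).  Balancedness
-- says: (lower bound) val_w(I) ≥ c whenever I contains an edge, and
-- (tightness) every edge lies in some I with val_w(I) = c.
-- For the constant weight 1 the lower bound is a rearrangement of the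
-- defining inequality e_I / (v_I - 2 + 1/m₂(F)) ≤ m₂(H,F); this needs the
-- denominators and m₂(H,F) to be positive, which follows from
-- m₂(F) ≥ d₂(K₂) = ½.  The weight is then made tight one edge e at a time:
-- μ = min { val_w(I) : e ∈ I } exists (induced subgraphs minimise val, so
-- it is a minimum over the finitely many vertex sets) and μ ≥ c; raising
-- w(e) by (μ - c)·m₂(H,F) lowers val by μ - c exactly on the subgraphs
-- containing e.  So the lower bound survives, e becomes tight, earlier
-- tight edges stay tight, and weights only grow.

open import Defs
open import Algebra.Bundles using (CommutativeMonoid)
open import Data.Bool using (Bool; true; false; if_then_else_; _∧_; _∨_)
open import Data.Bool.Properties using (T-≡; ∧-comm; ∧-identityʳ; ∨-zeroʳ)
import Data.Bool.Properties as Bool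
open import Data.Empty using (⊥-elim)
open import Data.Fin using (Fin; toℕ) renaming (zero to fzero; suc to fsuc)
open import Data.Fin.Properties using (_≟_)
import Data.Integer as ℤ
import Data.Integer.Properties as ℤP
open import Data.List using (List; []; _∷_; map; allFin; foldr; foldl; filter; cartesianProduct)
open import Data.List.Properties using (map-tabulate)
open import Data.List.Membership.Propositional using (_∈_)
open import Data.List.Membership.Propositional.Properties
  using (∈-filter⁺; ∈-cartesianProduct⁺; ∈-allFin)
open import Data.List.Relation.Unary.All using (All; _∷_)
open import Data.List.Relation.Unary.All.Properties using (all-filter)
open import Data.List.Relation.Unary.Any using (here; there)
open import Data.Nat as ℕ using (ℕ; zero; suc)
import Data.Nat.Properties as ℕP
import Data.Nat.Coprimality as Coprime
open import Data.Product using (Σ; _×_; _,_; proj₁; proj₂)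
open import Data.Rational.Base
open import Data.Rational.Properties hiding (_≟_)
open import Data.Rational.Properties using () renaming (_≟_ to _≟ℚ_)
open import Data.Rational.Solver using (module +-*-Solver)
open import Data.Sum using (_⊎_; inj₁; inj₂)
open import Function using (_∘_; id)
open import Function.Bundles using (Equivalence)
open import Relation.Binary.PropositionalEquality
open import Relation.Nullary using (yes; no; does)
open import Relation.Nullary.Decidable using (dec-true; _×-dec_)
open import Relation.Unary using (Decidable)

ℕtoℚ-canonical : ∀ k → ℕtoℚ k ≡ mkℚ (ℤ.+ k) 0 (Coprime.sym (Coprime.1-coprimeTo k))
ℕtoℚ-canonical k = normalize-coprime (Coprime.sym (Coprime.1-coprimeTo k))

ℕtoℚ-+ : ∀ a b → ℕtoℚ (a ℕ.+ b) ≡ ℕtoℚ a + ℕtoℚ b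
ℕtoℚ-+ a b
  rewrite ℕtoℚ-canonical a | ℕtoℚ-canonical b | ℕtoℚ-canonical (a ℕ.+ b)
        | ℕP.*-identityʳ a | ℕP.*-identityʳ b | ℤP.+◃n≡+n a | ℤP.+◃n≡+n b
  = sym (normalize-coprime _)

ℕtoℚ-nonNeg : ∀ k → 0ℚ ≤ ℕtoℚ k
ℕtoℚ-nonNeg k rewrite ℕtoℚ-canonical k = nonNegative⁻¹ _

ℕtoℚ-pos : ∀ {k} → 1 ℕ.≤ k → 0ℚ < ℕtoℚ k
ℕtoℚ-pos {suc k} _ rewrite ℕtoℚ-canonical (suc k) = positive⁻¹ _

ℕtoℚ-∸ : ∀ {a b} → b ℕ.≤ a → ℕtoℚ a - ℕtoℚ b ≡ ℕtoℚ (a ℕ.∸ b)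
ℕtoℚ-∸ {a} {b} b≤a = begin
  ℕtoℚ a - ℕtoℚ b                       ≡⟨ cong (λ x → ℕtoℚ x - ℕtoℚ b) (sym (ℕP.m∸n+n≡m b≤a)) ⟩
  ℕtoℚ (a ℕ.∸ b ℕ.+ b) - ℕtoℚ b         ≡⟨ cong (_- ℕtoℚ b) (ℕtoℚ-+ (a ℕ.∸ b) b) ⟩
  (ℕtoℚ (a ℕ.∸ b) + ℕtoℚ b) - ℕtoℚ b    ≡⟨ add-sub (ℕtoℚ (a ℕ.∸ b)) (ℕtoℚ b) ⟩
  ℕtoℚ (a ℕ.∸ b)                        ∎
  where
  open ≡-Reasoning
  add-sub : ∀ x y → (x + y) - y ≡ x
  add-sub = solve 2 (λ x y → (x :+ y) :- y := x) refl
    where open +-*-Solver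

recip : (m : ℚ) → 0ℚ < m → ℚ
recip m m>0 = (1/ m) {{pos⇒nonZero m {{positive m>0}}}}

recip-pos : ∀ m (m>0 : 0ℚ < m) → 0ℚ < recip m m>0
recip-pos m m>0 = positive⁻¹ _ {{1/pos⇒pos m {{positive m>0}}}}

*-*-recip : ∀ x m (m>0 : 0ℚ < m) → (x * m) * recip m m>0 ≡ x
*-*-recip x m m>0 = begin
  (x * m) * recip m m>0   ≡⟨ *-assoc x m _ ⟩
  x * (m * recip m m>0)   ≡⟨ cong (x *_) (*-inverseʳ m {{pos⇒nonZero m {{positive m>0}}}}) ⟩
  x * 1ℚ                  ≡⟨ *-identityʳ x ⟩
  x                       ∎
  where open ≡-Reasoning

*-recip-* : ∀ x m (m>0 : 0ℚ < m) → (x * recip m m>0) * m ≡ x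
*-recip-* x m m>0 = begin
  (x * recip m m>0) * m   ≡⟨ *-assoc x _ m ⟩
  x * (recip m m>0 * m)   ≡⟨ cong (x *_) (*-inverseˡ m {{pos⇒nonZero m {{positive m>0}}}}) ⟩
  x * 1ℚ                  ≡⟨ *-identityʳ x ⟩
  x                       ∎
  where open ≡-Reasoning

÷'-recip : ∀ x m (m>0 : 0ℚ < m) → x ÷' m ≡ x * recip m m>0
÷'-recip x m m>0 with m ≟ℚ 0ℚ
... | yes m≡0 = ⊥-elim (<-irrefl (sym m≡0) m>0)
... | no _    = refl

÷'-pos : ∀ {x m} → 0ℚ < x → 0ℚ < m → 0ℚ < x ÷' m
÷'-pos {x} {m} x>0 m>0 rewrite ÷'-recip x m m>0 =
  positive⁻¹ _ {{pos*pos⇒pos x {{positive x>0}} (recip m m>0) {{positive (recip-pos m m>0)}}}}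

÷'-swap : ∀ {e D m} (D>0 : 0ℚ < D) (m>0 : 0ℚ < m) → e ÷' D ≤ m → e ÷' m ≤ D
÷'-swap {e} {D} {m} D>0 m>0 e/D≤m = begin
  e ÷' m                  ≡⟨ ÷'-recip e m m>0 ⟩
  e * rm                  ≡⟨ cong (_* rm) (sym (*-recip-* e D D>0)) ⟩
  (e * rD) * D * rm       ≤⟨ *-monoʳ-≤-nonNeg rm (*-monoʳ-≤-nonNeg D e*rD≤m) ⟩
  m * D * rm              ≡⟨ cong (_* rm) (*-comm m D) ⟩
  D * m * rm              ≡⟨ *-*-recip D m m>0 ⟩
  D                       ∎
  where
  open ≤-Reasoning
  rD : ℚ
  rD = recip D D>0
  rm : ℚ
  rm = recip m m>0
  instance
    D≥0 : NonNegative D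
    D≥0 = nonNegative (<⇒≤ D>0)
    rm≥0 : NonNegative rm
    rm≥0 = nonNegative (<⇒≤ (recip-pos m m>0))
  e*rD≤m : e * rD ≤ m
  e*rD≤m = subst (_≤ m) (÷'-recip e D D>0) e/D≤m

sub-antitone : ∀ v {x y} → x ≤ y → v - y ≤ v - x
sub-antitone v x≤y = +-monoʳ-≤ v (neg-antimono-≤ x≤y)

sub-sub : ∀ x y → x - (x - y) ≡ y
sub-sub = solve 2 (λ x y → x :- (x :- y) := y) refl
  where open +-*-Solver

≤-+-nonNeg : ∀ x {g} → 0ℚ ≤ g → x ≤ x + g
≤-+-nonNeg x g≥0 = subst (_≤ x + _) (+-identityʳ x) (+-monoʳ-≤ x g≥0)

sub-nonNeg-≤ : ∀ x {g} → 0ℚ ≤ g → x - g ≤ x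
sub-nonNeg-≤ x g≥0 = subst (x - _ ≤_) (+-identityʳ x) (sub-antitone x g≥0)

map-allFin-suc : ∀ {b} {B : Set b} N (f : Fin (suc N) → B) →
                 map f (allFin (suc N)) ≡ f fzero ∷ map (f ∘ fsuc) (allFin N)
map-allFin-suc N f =
  cong (f fzero ∷_) (trans (map-tabulate fsuc f) (sym (map-tabulate id (f ∘ fsuc))))

module ListSum {c ℓ} (M : CommutativeMonoid c ℓ) where
  open CommutativeMonoid M
    renaming (refl to ≈-refl; sym to ≈-sym; trans to ≈-trans; reflexive to ≈-reflexive)
  open import Algebra.Properties.CommutativeSemigroup commutativeSemigroup using (interchange)

  ∑ : List Carrier → Carrier
  ∑ = foldr _∙_ ε

  ∑-cong : ∀ {B : Set} {f g : B → Carrier} → (∀ x → f x ≈ g x) →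
           ∀ xs → ∑ (map f xs) ≈ ∑ (map g xs)
  ∑-cong f≈g []       = ≈-refl
  ∑-cong f≈g (x ∷ xs) = ∙-cong (f≈g x) (∑-cong f≈g xs)

  ∑-∙ : ∀ {B : Set} (f g : B → Carrier) xs →
        ∑ (map (λ x → f x ∙ g x) xs) ≈ ∑ (map f xs) ∙ ∑ (map g xs)
  ∑-∙ f g []       = ≈-sym (identityˡ ε)
  ∑-∙ f g (x ∷ xs) = ≈-trans (∙-congˡ (∑-∙ f g xs)) (interchange (f x) (g x) _ _)

  ∑-ε : ∀ {B : Set} (xs : List B) → ∑ (map (λ _ → ε) xs) ≈ ε
  ∑-ε []       = ≈-refl
  ∑-ε (x ∷ xs) = ≈-trans (identityˡ _) (∑-ε xs)

  ∑-point : ∀ N (i : Fin N) a →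
            ∑ (map (λ k → if does (k ≟ i) then a else ε) (allFin N)) ≈ a
  ∑-point (suc N) fzero a = ≈-trans (≈-reflexive (cong ∑ (map-allFin-suc N _)))
                                  (≈-trans (∙-congˡ (∑-ε (allFin N))) (identityʳ a))
  ∑-point (suc N) (fsuc i) a = ≈-trans (≈-reflexive (cong ∑ (map-allFin-suc N _)))
                                     (≈-trans (identityˡ _) (∑-point N i a))

module ℕSum = ListSum ℕP.+-0-commutativeMonoid
module ℚSum = ListSum +-0-commutativeMonoid

sumℚ-mono : ∀ {B : Set} {f g : B → ℚ} → (∀ x → f x ≤ g x) →
            ∀ xs → sumℚ (map f xs) ≤ sumℚ (map g xs)
sumℚ-mono f≤g []       = ≤-refl
sumℚ-mono f≤g (x ∷ xs) = +-mono-≤ (f≤g x) (sumℚ-mono f≤g xs)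

sumℚ-ℕtoℚ : ∀ {B : Set} (f : B → ℕ) xs →
            sumℚ (map (ℕtoℚ ∘ f) xs) ≡ ℕtoℚ (sumℕ (map f xs))
sumℚ-ℕtoℚ f []       = refl
sumℚ-ℕtoℚ f (x ∷ xs) =
  trans (cong (ℕtoℚ (f x) +_) (sumℚ-ℕtoℚ f xs)) (sym (ℕtoℚ-+ (f x) _))

term≤sumℕ : ∀ N (f : Fin N → ℕ) k → f k ℕ.≤ sumℕ (map f (allFin N))
term≤sumℕ (suc N) f fzero    = ℕP.m≤m+n (f fzero) _
term≤sumℕ (suc N) f (fsuc k) = begin
  f (fsuc k)                                   ≤⟨ term≤sumℕ N (f ∘ fsuc) k ⟩
  sumℕ (map (f ∘ fsuc) (allFin N))             ≤⟨ ℕP.m≤n+m _ (f fzero) ⟩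
  f fzero ℕ.+ sumℕ (map (f ∘ fsuc) (allFin N)) ≡⟨ cong sumℕ (map-allFin-suc N f) ⟨
  sumℕ (map f (allFin (suc N)))                ∎
  where open ℕP.≤-Reasoning

two-terms≤sumℕ : ∀ N (f : Fin N → ℕ) {i j} → toℕ i ℕ.< toℕ j →
                 f i ℕ.+ f j ℕ.≤ sumℕ (map f (allFin N))
two-terms≤sumℕ (suc N) f {fzero} {fsuc j} _ = begin
  f fzero ℕ.+ f (fsuc j)                       ≤⟨ ℕP.+-monoʳ-≤ (f fzero) (term≤sumℕ N (f ∘ fsuc) j) ⟩
  f fzero ℕ.+ sumℕ (map (f ∘ fsuc) (allFin N)) ≡⟨ cong sumℕ (map-allFin-suc N f) ⟨
  sumℕ (map f (allFin (suc N)))                ∎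
  where open ℕP.≤-Reasoning
two-terms≤sumℕ (suc N) f {fsuc i} {fsuc j} (ℕ.s≤s i<j) = begin
  f (fsuc i) ℕ.+ f (fsuc j)                    ≤⟨ two-terms≤sumℕ N (f ∘ fsuc) i<j ⟩
  sumℕ (map (f ∘ fsuc) (allFin N))             ≤⟨ ℕP.m≤n+m _ (f fzero) ⟩
  f fzero ℕ.+ sumℕ (map (f ∘ fsuc) (allFin N)) ≡⟨ cong sumℕ (map-allFin-suc N f) ⟨
  sumℕ (map f (allFin (suc N)))                ∎
  where open ℕP.≤-Reasoning

-- eI and wI count an ordered pair (k,l) only when k < l; for such pairs
-- that test is vacuous.
ordered-flag : ∀ {k l : ℕ} → k ℕ.< l → ∀ b → (b ∧ (k ℕ.<ᵇ l)) ≡ b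
ordered-flag k<l b rewrite Equivalence.to T-≡ (ℕP.<⇒<ᵇ k<l) = ∧-identityʳ b

indicator : Bool → ℕ
indicator b = if b then 1 else 0

edge⇒eI≥1 : ∀ {G} (I : Sub G) {a b} → toℕ a ℕ.< toℕ b → E I a b ≡ true → 1 ℕ.≤ eI I
edge⇒eI≥1 {G} I {a} {b} a<b ab∈I = begin
  1          ≡⟨ cong indicator (sym (trans (ordered-flag a<b _) ab∈I)) ⟩
  entry a b  ≤⟨ term≤sumℕ (n G) (entry a) b ⟩
  row a      ≤⟨ term≤sumℕ (n G) row a ⟩
  eI I       ∎
  where
  open ℕP.≤-Reasoning
  entry : Fin (n G) → Fin (n G) → ℕ
  entry k l = indicator (E I k l ∧ (toℕ k ℕ.<ᵇ toℕ l))
  row : Fin (n G) → ℕ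
  row k = sumℕ (map (entry k) (allFin (n G)))

edge⇒vI≥2 : ∀ {G} (I : Sub G) {a b} → toℕ a ℕ.< toℕ b → E I a b ≡ true → 2 ℕ.≤ vI I
edge⇒vI≥2 {G} I {a} {b} a<b ab∈I = begin
  2                                         ≡⟨ cong₂ ℕ._+_ (cong indicator (sym a∈I)) (cong indicator (sym b∈I)) ⟩
  indicator (V I a) ℕ.+ indicator (V I b)   ≤⟨ two-terms≤sumℕ (n G) (indicator ∘ V I) a<b ⟩
  vI I                                      ∎
  where
  open ℕP.≤-Reasoning
  a∈I : V I a ≡ true
  a∈I = E⊆V I a b ab∈I
  b∈I : V I b ≡ true
  b∈I = E⊆V I b a (trans (E-sym I b a) ab∈I)

∧-true-left : ∀ {x y} → x ∧ y ≡ true → x ≡ true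
∧-true-left {true} _ = refl

∧-true-right : ∀ {x y} → x ∧ y ≡ true → y ≡ true
∧-true-right {true} y≡true = y≡true

induced : (G : Graph) → (Fin (n G) → Bool) → Sub G
induced G S = record
  { V     = S
  ; E     = λ k l → adj G k l ∧ (S k ∧ S l)
  ; E-sym = λ k l → cong₂ _∧_ (symm G k l) (∧-comm (S k) (S l))
  ; E⊆adj = λ k l kl∈E → ∧-true-left kl∈E
  ; E⊆V   = λ k l kl∈E → ∧-true-left (∧-true-right {adj G k l} kl∈E)
  }

addPair : ∀ {N} → Fin N → Fin N → (Fin N → Bool) → Fin N → Bool
addPair i j S k = does (k ≟ i) ∨ (does (k ≟ j) ∨ S k)

addPair-∋ : ∀ G {i j} S → adj G i j ≡ true → E (induced G (addPair i j S)) i j ≡ true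
addPair-∋ G {i} {j} S ij∈G
  rewrite ij∈G | dec-true (i ≟ i) refl | dec-true (j ≟ j) refl | ∨-zeroʳ (does (j ≟ i)) = refl

addPair-id : ∀ {N} {i j : Fin N} S → S i ≡ true → S j ≡ true → ∀ k → addPair i j S k ≡ S k
addPair-id {i = i} {j} S i∈S j∈S k with k ≟ i | k ≟ j
... | yes refl | _        = sym i∈S
... | no _     | yes refl = sym j∈S
... | no _     | no _     = refl

pair : ∀ {N} → Fin N → Fin N → Fin N → Bool
pair i j = addPair i j (λ _ → false)

edgeSub : (G : Graph) → Fin (n G) → Fin (n G) → Sub G
edgeSub G i j = induced G (pair i j)

pair-size : ∀ N {i j : Fin N} → toℕ i ℕ.< toℕ j →
            sumℕ (map (indicator ∘ pair i j) (allFin N)) ≡ 2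
pair-size N {i} {j} i<j = begin
  sumℕ (map (indicator ∘ pair i j) (allFin N))        ≡⟨ ℕSum.∑-cong split (allFin N) ⟩
  sumℕ (map (λ k → point i k ℕ.+ point j k) (allFin N)) ≡⟨ ℕSum.∑-∙ (point i) (point j) (allFin N) ⟩
  sumℕ (map (point i) (allFin N)) ℕ.+ sumℕ (map (point j) (allFin N))
                                                      ≡⟨ cong₂ ℕ._+_ (ℕSum.∑-point N i 1) (ℕSum.∑-point N j 1) ⟩
  2                                                   ∎
  where
  open ≡-Reasoning
  point : Fin N → Fin N → ℕ
  point x k = if does (k ≟ x) then 1 else 0
  split : ∀ k → indicator (pair i j k) ≡ point i k ℕ.+ point j k
  split k with k ≟ i | k ≟ j
  ... | yes refl | yes refl = ⊥-elim (ℕP.<-irrefl refl i<j)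
  ... | yes _    | no _     = refl
  ... | no _     | yes _    = refl
  ... | no _     | no _     = refl

edgeSub-vI : ∀ G {i j} → toℕ i ℕ.< toℕ j → vI (edgeSub G i j) ≡ 2
edgeSub-vI G i<j = pair-size (n G) i<j

IsEdgePair : (G : Graph) → Fin (n G) × Fin (n G) → Set
IsEdgePair G (i , j) = IsEdge G i j

isEdgePair? : (G : Graph) → Decidable (IsEdgePair G)
isEdgePair? G (i , j) = (toℕ i ℕ.<? toℕ j) ×-dec (adj G i j Bool.≟ true)

edges : (G : Graph) → List (Fin (n G) × Fin (n G))
edges G = filter (isEdgePair? G) (cartesianProduct (allFin (n G)) (allFin (n G)))

edges-complete : ∀ G {i j} → IsEdge G i j → (i , j) ∈ edges G
edges-complete G {i} {j} ij =
  ∈-filter⁺ (isEdgePair? G) (∈-cartesianProduct⁺ (∈-allFin i) (∈-allFin j)) ij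

edges-sound : ∀ G → All (IsEdgePair G) (edges G)
edges-sound G = all-filter (isEdgePair? G) (cartesianProduct (allFin (n G)) (allFin (n G)))

-- m₂(G) ≥ d₂(K₂) = ½ as soon as G has an edge.
½≤m₂ : ∀ G m → Nonempty G → IsM2 G m → ½ ≤ m
½≤m₂ G m (i , j , i<j , ij∈G) (_ , maximal) =
  subst (λ v → d2 v (eI K) ≤ m) (edgeSub-vI G i<j)
        (maximal K (edge⇒eI≥1 K i<j (addPair-∋ G _ ij∈G)))
  where
  K : Sub G
  K = edgeSub G i j

denominator-pos : ∀ {G} {mF} → 0ℚ < mF → (I : Sub G) → ∀ {a b} →
                  toℕ a ℕ.< toℕ b → E I a b ≡ true →
                  0ℚ < (ℕtoℚ (vI I) - ℕtoℚ 2) + (1ℚ ÷' mF)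
denominator-pos {mF = mF} mF>0 I a<b ab∈I =
  +-mono-≤-< v-2≥0 (÷'-pos (positive⁻¹ 1ℚ) mF>0)
  where
  v-2≥0 : 0ℚ ≤ ℕtoℚ (vI I) - ℕtoℚ 2
  v-2≥0 = subst (0ℚ ≤_) (sym (ℕtoℚ-∸ (edge⇒vI≥2 I a<b ab∈I))) (ℕtoℚ-nonNeg (vI I ℕ.∸ 2))

-- m₂(H,F) > 0: on the copy of K₂ the ratio is 1/(1/m₂(F)) > 0.
m₂HF-pos : ∀ H {mF mHF} → Nonempty H → 0ℚ < mF → IsM2HF H mF mHF → 0ℚ < mHF
m₂HF-pos H (a , b , a<b , ab∈H) mF>0 (_ , maximal) =
  <-≤-trans (÷'-pos (ℕtoℚ-pos eK≥1) (denominator-pos mF>0 K a<b K∋ab)) (maximal K eK≥1)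
  where
  K : Sub H
  K = edgeSub H a b
  K∋ab : E K a b ≡ true
  K∋ab = addPair-∋ H _ ab∈H
  eK≥1 : 1 ℕ.≤ eI K
  eK≥1 = edge⇒eI≥1 K a<b K∋ab

extend : ∀ {N} → Bool → (Fin N → Bool) → Fin (suc N) → Bool
extend b S fzero    = b
extend b S (fsuc k) = S k

-- f depends only on the values of its argument (there is no function
-- extensionality, so this has to be assumed).
Extensional : ∀ N → ((Fin N → Bool) → ℚ) → Set
Extensional N f = ∀ S S' → (∀ k → S k ≡ S' k) → f S ≡ f S'

minOver : ∀ N → ((Fin N → Bool) → ℚ) → ℚ
minOver zero    f = f (λ ())
minOver (suc N) f = minOver N (f ∘ extend false) ⊓ minOver N (f ∘ extend true)

minOver-≤ : ∀ N f → Extensional N f → ∀ S → minOver N f ≤ f S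
minOver-≤ zero    f ext S = ≤-reflexive (ext _ _ λ ())
minOver-≤ (suc N) f ext S = ≤-trans branch≤ (≤-reflexive (ext _ S (λ { fzero → refl ; (fsuc k) → refl })))
  where
  branch : Bool → ℚ
  branch b = minOver N (f ∘ extend b)
  ext-extend : ∀ b → Extensional N (f ∘ extend b)
  ext-extend b T T' T≗T' = ext _ _ λ { fzero → refl ; (fsuc k) → T≗T' k }
  branch≤ : minOver (suc N) f ≤ f (extend (S fzero) (S ∘ fsuc))
  branch≤ with S fzero
  ... | false = ≤-trans (p⊓q≤p (branch false) (branch true)) (minOver-≤ N _ (ext-extend false) (S ∘ fsuc))
  ... | true  = ≤-trans (p⊓q≤q (branch false) (branch true)) (minOver-≤ N _ (ext-extend true) (S ∘ fsuc))

minOver-attained : ∀ N f → Σ (Fin N → Bool) λ S → minOver N f ≡ f S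
minOver-attained zero    f = (λ ()) , refl
minOver-attained (suc N) f
  with ≤-total (minOver N (f ∘ extend false)) (minOver N (f ∘ extend true))
... | inj₁ left≤right =
  let (S , attained) = minOver-attained N (f ∘ extend false)
  in extend false S , trans (p≤q⇒p⊓q≡p left≤right) attained
... | inj₂ right≤left =
  let (S , attained) = minOver-attained N (f ∘ extend true)
  in extend true S , trans (p≥q⇒p⊓q≡q right≤left) attained

-- Fixed: the graph H, the normalising constant m > 0 (later m₂(H,F)) and the
-- target value c (later 2 - 1/m₂(F)).  Weights live on ordered pairs; only
-- pairs i < j that are edges matter.
module Balancing (H : Graph) (m : ℚ) (m>0 : 0ℚ < m) (c : ℚ) where

  N : ℕ
  N = n H

  Weight : Set
  Weight = Fin N → Fin N → ℚ

  val : Weight → Sub H → ℚ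
  val w I = ℕtoℚ (vI I) - (wI w I ÷' m)

  r : ℚ
  r = recip m m>0

  val-recip : ∀ w I → val w I ≡ ℕtoℚ (vI I) - wI w I * r
  val-recip w I = cong (λ x → ℕtoℚ (vI I) - x) (÷'-recip (wI w I) m m>0)

  LowerBound : Weight → Set
  LowerBound w = ∀ (I : Sub H) a b → IsEdge H a b → E I a b ≡ true → c ≤ val w I

  Tight : Weight → Fin N → Fin N → Set
  Tight w a b = Σ (Sub H) λ I → (E I a b ≡ true) × (val w I ≡ c)

  AllTight : Weight → Set
  AllTight w = ∀ a b → IsEdge H a b → Tight w a b

  AtLeast1 : Weight → Set
  AtLeast1 w = ∀ a b → 1ℚ ≤ w a b

  val-induced-cong : ∀ w S S' → (∀ k → S k ≡ S' k) → val w (induced H S) ≡ val w (induced H S')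
  val-induced-cong w S S' S≗S' = cong₂ (λ v x → ℕtoℚ v - (x ÷' m))
    (ℕSum.∑-cong (λ k → cong indicator (S≗S' k)) (allFin N))
    (ℚSum.∑-cong (λ k → ℚSum.∑-cong (λ l → cong (λ b → if (adj H k l ∧ b) ∧ (toℕ k ℕ.<ᵇ toℕ l) then w k l else 0ℚ)
                                                 (cong₂ _∧_ (S≗S' k) (S≗S' l))) (allFin N)) (allFin N))

  -- For nonnegative weights, the induced subgraph on the vertices of I has
  -- all edges of I (and possibly more), so it has smaller val.
  val-induced-≤ : ∀ w → (∀ a b → 0ℚ ≤ w a b) → (I : Sub H) → val w (induced H (V I)) ≤ val w I
  val-induced-≤ w w≥0 I = begin
    val w (induced H (V I))                         ≡⟨ val-recip w (induced H (V I)) ⟩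
    ℕtoℚ (vI I) - wI w (induced H (V I)) * r        ≤⟨ sub-antitone (ℕtoℚ (vI I)) (*-monoʳ-≤-nonNeg r {{r≥0}} wI≤) ⟩
    ℕtoℚ (vI I) - wI w I * r                        ≡⟨ val-recip w I ⟨
    val w I                                         ∎
    where
    open ≤-Reasoning
    r≥0 : NonNegative r
    r≥0 = nonNegative (<⇒≤ (recip-pos m m>0))
    term≤ : ∀ k l → (if E I k l ∧ (toℕ k ℕ.<ᵇ toℕ l) then w k l else 0ℚ)
                  ≤ (if E (induced H (V I)) k l ∧ (toℕ k ℕ.<ᵇ toℕ l) then w k l else 0ℚ)
    term≤ k l with E I k l in kl∈I
    ... | true rewrite E⊆adj I k l kl∈I | E⊆V I k l kl∈I | E⊆V I l k (trans (E-sym I l k) kl∈I) = ≤-refl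
    ... | false with E (induced H (V I)) k l ∧ (toℕ k ℕ.<ᵇ toℕ l)
    ...   | true  = w≥0 k l
    ...   | false = ≤-refl
    wI≤ : wI w I ≤ wI w (induced H (V I))
    wI≤ = sumℚ-mono (λ k → sumℚ-mono (term≤ k) (allFin N)) (allFin N)

  -- μ_w(ij) = min { val_w(I) : ij ∈ I }, computed over the induced
  -- subgraphs on vertex sets containing i and j.
  μ : Weight → Fin N → Fin N → ℚ
  μ w i j = minOver N (λ S → val w (induced H (addPair i j S)))

  μ-≤ : ∀ w → (∀ a b → 0ℚ ≤ w a b) → ∀ {i j} (I : Sub H) → E I i j ≡ true → μ w i j ≤ val w I
  μ-≤ w w≥0 {i} {j} I ij∈I = begin
    μ w i j                                ≤⟨ minOver-≤ N _ ext (V I) ⟩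
    val w (induced H (addPair i j (V I)))  ≡⟨ val-induced-cong w _ _ (addPair-id (V I) i∈I j∈I) ⟩
    val w (induced H (V I))                ≤⟨ val-induced-≤ w w≥0 I ⟩
    val w I                                ∎
    where
    open ≤-Reasoning
    i∈I : V I i ≡ true
    i∈I = E⊆V I i j ij∈I
    j∈I : V I j ≡ true
    j∈I = E⊆V I j i (trans (E-sym I j i) ij∈I)
    ext : Extensional N (λ S → val w (induced H (addPair i j S)))
    ext S S' S≗S' = val-induced-cong w _ _ (λ k → cong (λ b → does (k ≟ i) ∨ (does (k ≟ j) ∨ b)) (S≗S' k))

  μ-attained : ∀ w {i j} → IsEdge H i j → Σ (Sub H) λ I → (E I i j ≡ true) × (val w I ≡ μ w i j)
  μ-attained w {i} {j} (_ , ij∈H) =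
    let (S , attained) = minOver-attained N (λ S → val w (induced H (addPair i j S)))
    in induced H (addPair i j S) , addPair-∋ H S ij∈H , sym attained

  raise : Weight → Fin N → Fin N → ℚ → Weight
  raise w i j δ k l = if does (k ≟ i) ∧ does (l ≟ j) then w k l + δ else w k l

  counted : Sub H → Fin N → Fin N → ℚ → ℚ
  counted I i j δ = if E I i j ∧ (toℕ i ℕ.<ᵇ toℕ j) then δ else 0ℚ

  wI-raise : ∀ w i j δ I → wI (raise w i j δ) I ≡ wI w I + counted I i j δ
  wI-raise w i j δ I = begin
    wI (raise w i j δ) I                                  ≡⟨ ℚSum.∑-cong (λ k → ℚSum.∑-cong (term-split k) (allFin N)) (allFin N) ⟩
    ∑Fin (λ k → ∑Fin (λ l → term w k l + bump k l))       ≡⟨ ℚSum.∑-cong (λ k → ℚSum.∑-∙ (term w k) (bump k) (allFin N)) (allFin N) ⟩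
    ∑Fin (λ k → ∑Fin (term w k) + ∑Fin (bump k))          ≡⟨ ℚSum.∑-∙ (λ k → ∑Fin (term w k)) (λ k → ∑Fin (bump k)) (allFin N) ⟩
    wI w I + ∑Fin (λ k → ∑Fin (bump k))                   ≡⟨ cong (wI w I +_) (ℚSum.∑-cong row-bump (allFin N)) ⟩
    wI w I + ∑Fin (λ k → if does (k ≟ i) then X else 0ℚ)  ≡⟨ cong (wI w I +_) (ℚSum.∑-point N i X) ⟩
    wI w I + X                                            ∎
    where
    open ≡-Reasoning
    X : ℚ
    X = counted I i j δ
    ∑Fin : (Fin N → ℚ) → ℚ
    ∑Fin f = sumℚ (map f (allFin N))
    term : Weight → Fin N → Fin N → ℚ
    term u k l = if E I k l ∧ (toℕ k ℕ.<ᵇ toℕ l) then u k l else 0ℚ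
    bump : Fin N → Fin N → ℚ
    bump k l = if does (k ≟ i) then (if does (l ≟ j) then X else 0ℚ) else 0ℚ
    term-split : ∀ k l → term (raise w i j δ) k l ≡ term w k l + bump k l
    term-split k l with k ≟ i | l ≟ j
    ... | no _     | _        = sym (+-identityʳ _)
    ... | yes _    | no _     = sym (+-identityʳ _)
    ... | yes refl | yes refl with E I k l ∧ (toℕ k ℕ.<ᵇ toℕ l)
    ...   | true  = refl
    ...   | false = sym (+-identityʳ 0ℚ)
    row-bump : ∀ k → ∑Fin (bump k) ≡ (if does (k ≟ i) then X else 0ℚ)
    row-bump k with does (k ≟ i)
    ... | true  = ℚSum.∑-point N j X
    ... | false = ℚSum.∑-ε (allFin N)

  val-raise : ∀ w i j δ I → val (raise w i j δ) I ≡ val w I - counted I i j δ * r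
  val-raise w i j δ I = begin
    val (raise w i j δ) I            ≡⟨ val-recip (raise w i j δ) I ⟩
    v - wI (raise w i j δ) I * r     ≡⟨ cong (λ x → v - x * r) (wI-raise w i j δ I) ⟩
    v - (wI w I + X) * r             ≡⟨ sub-distrib v (wI w I) X r ⟩
    (v - wI w I * r) - X * r         ≡⟨ cong (_- X * r) (val-recip w I) ⟨
    val w I - X * r                  ∎
    where
    open ≡-Reasoning
    v : ℚ
    v = ℕtoℚ (vI I)
    X : ℚ
    X = counted I i j δ
    sub-distrib : ∀ v a b r → v - (a + b) * r ≡ (v - a * r) - b * r
    sub-distrib = solve 4 (λ v a b r → v :- (a :+ b) :* r := (v :- a :* r) :- b :* r) refl
      where open +-*-Solver

  -- Raise the weight of ij by (μ - c)·m, the amount that makes ij tight.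
  raiseEdge : Weight → Fin N × Fin N → Weight
  raiseEdge w (i , j) = raise w i j ((μ w i j - c) * m)

  module RaiseEdge (w : Weight) {i j : Fin N} (ij : IsEdge H i j)
                   (lower : LowerBound w) (w≥1 : AtLeast1 w) where

    w′ : Weight
    w′ = raiseEdge w (i , j)

    gap : ℚ
    gap = μ w i j - c

    w≥0 : ∀ a b → 0ℚ ≤ w a b
    w≥0 a b = ≤-trans (nonNegative⁻¹ 1ℚ) (w≥1 a b)

    minimiser : Σ (Sub H) λ I → (E I i j ≡ true) × (val w I ≡ μ w i j)
    minimiser = μ-attained w ij

    I* : Sub H
    I* = proj₁ minimiser

    ij∈I* : E I* i j ≡ true
    ij∈I* = proj₁ (proj₂ minimiser)

    val-I* : val w I* ≡ μ w i j
    val-I* = proj₂ (proj₂ minimiser)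

    -- The lower bound at the minimiser gives μ ≥ c, so the raise is upward.
    gap≥0 : 0ℚ ≤ gap
    gap≥0 = subst (_≤ gap) (+-inverseʳ c)
      (+-monoˡ-≤ (- c) (subst (c ≤_) val-I* (lower I* i j ij ij∈I*)))

    δ≥0 : 0ℚ ≤ gap * m
    δ≥0 = subst (_≤ gap * m) (*-zeroˡ m) (*-monoʳ-≤-nonNeg m {{nonNegative (<⇒≤ m>0)}} gap≥0)

    val-∋ : ∀ I → E I i j ≡ true → val w′ I ≡ val w I - gap
    val-∋ I ij∈I = begin
      val w′ I                              ≡⟨ val-raise w i j (gap * m) I ⟩
      val w I - counted I i j (gap * m) * r ≡⟨ cong (λ b → val w I - (if b then gap * m else 0ℚ) * r) ij-counted ⟩
      val w I - gap * m * r                 ≡⟨ cong (λ x → val w I - x) (*-*-recip gap m m>0) ⟩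
      val w I - gap                         ∎
      where
      open ≡-Reasoning
      ij-counted : (E I i j ∧ (toℕ i ℕ.<ᵇ toℕ j)) ≡ true
      ij-counted = trans (ordered-flag (proj₁ ij) _) ij∈I

    val-∌ : ∀ I → E I i j ≡ false → val w′ I ≡ val w I
    val-∌ I ij∉I = begin
      val w′ I                              ≡⟨ val-raise w i j (gap * m) I ⟩
      val w I - counted I i j (gap * m) * r ≡⟨ cong (λ b → val w I - (if b ∧ (toℕ i ℕ.<ᵇ toℕ j) then gap * m else 0ℚ) * r) ij∉I ⟩
      val w I - 0ℚ * r                      ≡⟨ cong (λ x → val w I - x) (*-zeroˡ r) ⟩
      val w I - 0ℚ                          ≡⟨ +-identityʳ (val w I) ⟩
      val w I                               ∎
      where open ≡-Reasoning

    val-≤ : ∀ I → val w′ I ≤ val w I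
    val-≤ I = by-membership (E I i j) refl
      where
      by-membership : ∀ b → E I i j ≡ b → val w′ I ≤ val w I
      by-membership true  ij∈I = subst (_≤ val w I) (sym (val-∋ I ij∈I)) (sub-nonNeg-≤ (val w I) gap≥0)
      by-membership false ij∉I = ≤-reflexive (val-∌ I ij∉I)

    lower′ : LowerBound w′
    lower′ I a b ab ab∈I = by-membership (E I i j) refl
      where
      open ≤-Reasoning
      by-membership : ∀ x → E I i j ≡ x → c ≤ val w′ I
      by-membership true ij∈I = begin
        c                  ≡⟨ sub-sub (μ w i j) c ⟨
        μ w i j - gap      ≤⟨ +-monoˡ-≤ (- gap) (μ-≤ w w≥0 I ij∈I) ⟩
        val w I - gap      ≡⟨ val-∋ I ij∈I ⟨
        val w′ I           ∎
      by-membership false ij∉I = subst (c ≤_) (sym (val-∌ I ij∉I)) (lower I a b ab ab∈I)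

    w′≥1 : AtLeast1 w′
    w′≥1 a b = raised-or-not (does (a ≟ i) ∧ does (b ≟ j))
      where
      raised-or-not : ∀ x → 1ℚ ≤ (if x then w a b + gap * m else w a b)
      raised-or-not true  = ≤-trans (w≥1 a b) (≤-+-nonNeg (w a b) δ≥0)
      raised-or-not false = w≥1 a b

    tight-new : Tight w′ i j
    tight-new = I* , ij∈I* , ≤-antisym (begin
      val w′ I*          ≡⟨ val-∋ I* ij∈I* ⟩
      val w I* - gap     ≡⟨ cong (_- gap) val-I* ⟩
      μ w i j - gap      ≡⟨ sub-sub (μ w i j) c ⟩
      c                  ∎) (lower′ I* i j ij ij∈I*)
      where open ≤-Reasoning

    tight-kept : ∀ {a b} → IsEdge H a b → Tight w a b → Tight w′ a b
    tight-kept ab (I , ab∈I , tight) =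
      I , ab∈I , ≤-antisym (≤-trans (val-≤ I) (≤-reflexive tight)) (lower′ I _ _ ab ab∈I)

  raiseAll-correct :
    ∀ ps w → All (IsEdgePair H) ps → LowerBound w → AtLeast1 w →
    (∀ {a b} → IsEdge H a b → Tight w a b ⊎ (a , b) ∈ ps) →
    LowerBound (foldl raiseEdge w ps) × AtLeast1 (foldl raiseEdge w ps) × AllTight (foldl raiseEdge w ps)
  raiseAll-correct [] w _ lower w≥1 pending = lower , w≥1 , λ a b ab → done (pending ab)
    where
    done : ∀ {a b} → Tight w a b ⊎ (a , b) ∈ [] → Tight w a b
    done (inj₁ tight) = tight
  raiseAll-correct ((i , j) ∷ ps) w (ij ∷ ps-edges) lower w≥1 pending =
    raiseAll-correct ps w′ ps-edges lower′ w′≥1 pending′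
    where
    open RaiseEdge w ij lower w≥1
    advance : ∀ {a b} → IsEdge H a b → Tight w a b ⊎ (a , b) ∈ ((i , j) ∷ ps) → Tight w′ a b ⊎ (a , b) ∈ ps
    advance ab (inj₁ tight)       = inj₁ (tight-kept ab tight)
    advance ab (inj₂ (here refl)) = inj₁ tight-new
    advance ab (inj₂ (there p))   = inj₂ p
    pending′ : ∀ {a b} → IsEdge H a b → Tight w′ a b ⊎ (a , b) ∈ ps
    pending′ ab = advance ab (pending ab)

  balance : ∀ w → LowerBound w → AtLeast1 w →
            Σ Weight λ w′ → LowerBound w′ × AtLeast1 w′ × AllTight w′
  balance w lower w≥1 =
    foldl raiseEdge w (edges H) ,
    raiseAll-correct (edges H) w (edges-sound H) lower w≥1 (λ ab → inj₂ (edges-complete H ab))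

wI-unit : ∀ {G} (I : Sub G) → wI (λ _ _ → 1ℚ) I ≡ ℕtoℚ (eI I)
wI-unit {G} I =
  trans (ℚSum.∑-cong (λ k → trans (ℚSum.∑-cong (λ l → term (E I k l ∧ (toℕ k ℕ.<ᵇ toℕ l))) (allFin (n G)))
                                  (sumℚ-ℕtoℚ _ (allFin (n G))))
                     (allFin (n G)))
        (sumℚ-ℕtoℚ _ (allFin (n G)))
  where
  term : ∀ b → (if b then 1ℚ else 0ℚ) ≡ ℕtoℚ (indicator b)
  term true  = refl
  term false = refl

-- The weight 1 has lower bound 2 - 1/m₂(F): rearranging the defining
-- inequality e_I / (v_I - 2 + 1/m₂(F)) ≤ m₂(H,F).
unit-lowerBound : ∀ H {mF mHF} (mF>0 : 0ℚ < mF) (mHF>0 : 0ℚ < mHF) → IsM2HF H mF mHF →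
                  Balancing.LowerBound H mHF mHF>0 (ℕtoℚ 2 - (1ℚ ÷' mF)) (λ _ _ → 1ℚ)
unit-lowerBound H {mF} {mHF} mF>0 mHF>0 (_ , maximal) I a b (a<b , _) ab∈I = begin
  ℕtoℚ 2 - s                          ≡⟨ shift v (ℕtoℚ 2) s ⟩
  v - D                               ≤⟨ sub-antitone v (÷'-swap D>0 mHF>0 (maximal I (edge⇒eI≥1 I a<b ab∈I))) ⟩
  v - (ℕtoℚ (eI I) ÷' mHF)            ≡⟨ cong (λ x → v - (x ÷' mHF)) (wI-unit I) ⟨
  v - (wI (λ _ _ → 1ℚ) I ÷' mHF)      ∎
  where
  open ≤-Reasoning
  v : ℚ
  v = ℕtoℚ (vI I)
  s : ℚ
  s = 1ℚ ÷' mF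
  D : ℚ
  D = (v - ℕtoℚ 2) + s
  D>0 : 0ℚ < D
  D>0 = denominator-pos mF>0 I a<b ab∈I
  shift : ∀ v t s → t - s ≡ v - ((v - t) + s)
  shift = solve 3 (λ v t s → t :- s := v :- ((v :- t) :+ s)) refl
    where open +-*-Solver

-- The hypotheses on m₂(H) only make m₂(H,F) meaningful; the argument
-- needs just the positivity of m₂(F) and m₂(H,F).
lemma4p2 : (H F : Graph) → Nonempty H → Nonempty F →
    (mH mF mHF : ℚ) → IsM2 H mH → IsM2 F mF → mF ≤ mH → IsM2HF H mF mHF →
    Σ (Fin (n H) → Fin (n H) → ℚ) (λ w →
      (∀ i j → IsEdge H i j → 1ℚ ≤ w i j) × Balanced H w mF mHF)
lemma4p2 H F H-nonempty F-nonempty _ mF mHF _ m₂F _ m₂HF =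
  let (w , lower , w≥1 , tight) = balance (λ _ _ → 1ℚ) (unit-lowerBound H mF>0 mHF>0 m₂HF) (λ _ _ → ≤-refl)
  in w , (λ a b _ → w≥1 a b) , (λ a b ab → (λ I ab∈I → lower I a b ab ab∈I) , tight a b ab)
  where
  mF>0 : 0ℚ < mF
  mF>0 = <-≤-trans (positive⁻¹ ½) (½≤m₂ F mF F-nonempty m₂F)
  mHF>0 : 0ℚ < mHF
  mHF>0 = m₂HF-pos H H-nonempty mF>0 m₂HF
  open Balancing H mHF mHF>0 (ℕtoℚ 2 - (1ℚ ÷' mF))
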